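{- For all integers $n,k\geq 0$ and every nonzero $\lambda\in\mathbb{C}$, \[ y_{2}(n,k;-\lambda)=\frac{k!}{(2k)!}\sum_{j=0}^{k}\sum_{d=0}^{n}(-1)^{k+n-d}\binom{n}{d}S_{2}(d,j;\lambda)\,S_{2}(n-d,k-j;\lambda^{ -1}). \]
   Context: For $\lambda\neq 0$ and $k\in\mathbb{N}_0$, the numbers $y_{2}(n,k;\lambda)$ are defined by $\frac{1}{(2k)!}(\lambda e^{t}+\lambda^{ -1}e^{ -t}+2)^{k}=\sum_{n=0}^{\infty}y_{2}(n,k;\lambda)\frac{t^{n}}{n!}$. For $v\in\mathbb{N}_0$ and $\lambda\in\mathbb{C}$, the $\lambda$-Stirling numbers of the second kind $S_{2}(n,v;\lambda)$ are defined by $\frac{(\lambda e^{t}-1)^{v}}{v!}=\sum_{n=0}^{\infty}S_{2}(n,v;\lambda)\frac{t^{n}}{n!}$. -}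

module Defs where

open import Level using (Level)
open import Data.Nat using (ℕ; zero; suc) renaming (_+_ to _+ℕ_; _∸_ to _∸ℕ_)
open import Data.Nat.Combinatorics using (_C_)
open import Data.Nat using () renaming (_! to _!ℕ)
open import Algebra.Bundles using (CommutativeRing)

-- Everything is developed over an arbitrary commutative ring R
-- (instantiated at ℂ in the paper). `inv m` is meant to be an inverse
-- of the integer m+1 in R (hypothesis stated in the theorem).
module Gen {c ℓ : Level} (R : CommutativeRing c ℓ) (inv : ℕ → CommutativeRing.Carrier R) where
  open CommutativeRing R

  natR : ℕ → Carrier
  natR zero    = 0#
  natR (suc n) = 1# + natR n

  sgn : ℕ → Carrier
  sgn zero    = 1#
  sgn (suc m) = - sgn m

  powR : Carrier → ℕ → Carrier
  powR x zero    = 1#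
  powR x (suc m) = x * powR x m

  sumTo : ℕ → (ℕ → Carrier) → Carrier
  sumTo zero    f = f 0
  sumTo (suc n) f = sumTo n f + f (suc n)

  invFact : ℕ → Carrier
  invFact zero    = 1#
  invFact (suc m) = inv m * invFact m

  -- Exponential generating functions are represented by their sequence of
  -- coefficients a n, i.e.  Σ a n t^n / n!.
  EGF : Set c
  EGF = ℕ → Carrier

  _⋆_ : EGF → EGF → EGF
  (a ⋆ b) n = sumTo n (λ d → natR (n C d) * (a d * b (n ∸ℕ d)))

  _⊕_ : EGF → EGF → EGF
  (a ⊕ b) n = a n + b n

  constE : Carrier → EGF
  constE r zero    = r
  constE r (suc _) = 0#

  -- r e^{t}
  expE : Carrier → EGF
  expE r n = r

  -- r e^{-t}
  expNegE : Carrier → EGF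
  expNegE r n = r * sgn n

  powE : EGF → ℕ → EGF
  powE a zero    = constE 1#
  powE a (suc k) = a ⋆ powE a k

  -- y₂(n,k;λ), where λ' is the inverse λ⁻¹ of λ:
  -- (1/(2k)!) (λ e^t + λ⁻¹ e^{-t} + 2)^k = Σ y₂(n,k;λ) t^n/n!
  y2 : ℕ → ℕ → Carrier → Carrier → Carrier
  y2 n k lam lam' =
    invFact (k +ℕ k) * powE ((expE lam ⊕ expNegE lam') ⊕ constE (natR 2)) k n

  -- λ-Stirling numbers of the second kind:
  -- (λ e^t - 1)^v / v! = Σ S₂(n,v;λ) t^n/n!
  S2 : ℕ → ℕ → Carrier → Carrier
  S2 n v lam = invFact v * powE (expE lam ⊕ constE (- 1#)) v n

module Submission where

-- Exponential generating functions over R (coefficient sequences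
-- under binomial convolution ⋆) form a commutative semiring.  Write
--   A = λ e^t - 1,   A' = λ' e^t - 1,   (σ a)(t) = a(-t),  i.e. (σ a)_n = (-1)^n a_n.
-- Then -λ e^t - λ' e^{-t} + 2 = -(A + σ A'), so the binomial theorem gives
--   (-λ e^t - λ' e^{-t} + 2)^k = (-1)^k Σ_j C(k,j) A^j (σ A')^(k-j).
-- As σ is multiplicative, (σ A')^(k-j) = σ (A'^(k-j)); moreover A^j = j! S₂(·,j;λ),
-- A'^(k-j) = (k-j)! S₂(·,k-j;λ') and C(k,j) = k!/(j!(k-j)!).  Reading off the
-- n-th coefficient yields the formula.

open import Defs
open import Level using (Level)
open import Data.Nat using (ℕ; zero; suc; _≤_; z≤n) renaming (_+_ to _+ℕ_; _∸_ to _∸ℕ_; _*_ to _*ℕ_)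
open import Data.Nat using () renaming (_! to _!ℕ)
open import Data.Nat.Combinatorics using (_C_; nCn≡1; nCk≡nC[n∸k])
import Data.Nat.Properties as ℕₚ
open import Data.Fin using (toℕ)
open import Relation.Binary.PropositionalEquality as ≡ using (_≡_)
open import Algebra.Bundles using (CommutativeRing; CommutativeSemiring)
open import Relation.Binary.Structures using (IsEquivalence)
open import Algebra.Structures.Biased using (isCommutativeMonoidʳ; isCommutativeSemiringʳ)
import Algebra.Solver.CommutativeMonoid as CommutativeMonoidSolver
import Algebra.Properties.Ring as RingProperties
import Algebra.Properties.CommutativeSemigroup as CommutativeSemigroupProperties
import Algebra.Definitions.RawSemiring as RawSemiringDefinitions
import Algebra.Properties.CommutativeSemiring.Binomial as Binomial

module ChooseFactorial where
  open import Data.Nat using (_+_; _*_; _∸_; _/_; _!; NonZero)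
  open import Data.Nat.Combinatorics using (k![n∸k]!∣n!)
  import Data.Nat.Combinatorics.Specification as Spec
  open import Data.Nat.DivMod using (m/n*n≡m)
  open import Data.Nat.Solver using (module +-*-Solver)
  open +-*-Solver using (solve; _:*_; _:=_)
  open ≡.≡-Reasoning

  choose-factorial : ∀ {n k} → k ≤ n → (n C k) * (k ! * (n ∸ k) !) ≡ n !
  choose-factorial {n} {k} k≤n = begin
    (n C k) * (k ! * (n ∸ k) !)                      ≡⟨ ≡.cong (_* (k ! * (n ∸ k) !)) (Spec.nCk≡n!/k![n-k]! k≤n) ⟩
    (n ! / (k ! * (n ∸ k) !)) * (k ! * (n ∸ k) !)   ≡⟨ m/n*n≡m (k![n∸k]!∣n! k≤n) ⟩
    n !                                              ∎
    where
    instance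
      k!*[n-k]!≢0 : NonZero (k ! * (n ∸ k) !)
      k!*[n-k]!≢0 = ℕₚ._!*_!≢0 k (n ∸ k)

  -- Both sides multiplied by i! j! (n-i-j)! equal n!.
  choose-choose : ∀ n i j → i + j ≤ n → (n C (i + j)) * ((i + j) C i) ≡ (n C i) * ((n ∸ i) C j)
  choose-choose n i j i+j≤n = ℕₚ.*-cancelʳ-≡ _ _ (i ! * (j ! * r !)) {{nonZero}} (≡.trans viaSum (≡.sym viaI))
    where
    r : ℕ
    r = n ∸ (i + j)
    nonZero : NonZero (i ! * (j ! * r !))
    nonZero = ℕₚ.m*n≢0 (i !) _ {{ℕₚ._!≢0 i}} {{ℕₚ._!*_!≢0 j r}}
    regroupˡ : ∀ a b x y z → (a * b) * (x * (y * z)) ≡ a * ((b * (x * y)) * z)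
    regroupˡ = solve 5 (λ a b x y z → (a :* b) :* (x :* (y :* z)) := a :* ((b :* (x :* y)) :* z)) ≡.refl
    regroupʳ : ∀ a b x y z → (a * b) * (x * (y * z)) ≡ a * (x * (b * (y * z)))
    regroupʳ = solve 5 (λ a b x y z → (a :* b) :* (x :* (y :* z)) := a :* (x :* (b :* (y :* z)))) ≡.refl
    viaSum : (n C (i + j)) * ((i + j) C i) * (i ! * (j ! * r !)) ≡ n !
    viaSum = begin
      (n C (i + j)) * ((i + j) C i) * (i ! * (j ! * r !))          ≡⟨ regroupˡ (n C (i + j)) _ (i !) (j !) (r !) ⟩
      (n C (i + j)) * (((i + j) C i) * (i ! * j !) * r !)          ≡⟨ ≡.cong (λ m → (n C (i + j)) * (((i + j) C i) * (i ! * m !) * r !)) (≡.sym (ℕₚ.m+n∸m≡n i j)) ⟩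
      (n C (i + j)) * (((i + j) C i) * (i ! * (i + j ∸ i) !) * r !) ≡⟨ ≡.cong (λ m → (n C (i + j)) * (m * r !)) (choose-factorial (ℕₚ.m≤m+n i j)) ⟩
      (n C (i + j)) * ((i + j) ! * r !)                              ≡⟨ choose-factorial i+j≤n ⟩
      n !                                                            ∎
    viaI : (n C i) * ((n ∸ i) C j) * (i ! * (j ! * r !)) ≡ n !
    viaI = begin
      (n C i) * ((n ∸ i) C j) * (i ! * (j ! * r !))               ≡⟨ regroupʳ (n C i) _ (i !) (j !) (r !) ⟩
      (n C i) * (i ! * (((n ∸ i) C j) * (j ! * r !)))             ≡⟨ ≡.cong (λ m → (n C i) * (i ! * (((n ∸ i) C j) * (j ! * m !)))) (≡.sym (ℕₚ.∸-+-assoc n i j)) ⟩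
      (n C i) * (i ! * (((n ∸ i) C j) * (j ! * (n ∸ i ∸ j) !)))   ≡⟨ ≡.cong (λ m → (n C i) * (i ! * m)) (choose-factorial j≤n∸i) ⟩
      (n C i) * (i ! * (n ∸ i) !)                                 ≡⟨ choose-factorial (ℕₚ.m+n≤o⇒m≤o i i+j≤n) ⟩
      n !                                                         ∎
      where
      j≤n∸i : j ≤ n ∸ i
      j≤n∸i = ℕₚ.m+n≤o⇒m≤o∸n j (≡.subst (_≤ n) (ℕₚ.+-comm i j) i+j≤n)

open ChooseFactorial using (choose-factorial; choose-choose)

module Development {c ℓ : Level} (R : CommutativeRing c ℓ) (inv : ℕ → CommutativeRing.Carrier R) where
  open CommutativeRing R hiding (zero)
  open Gen R inv
  open import Relation.Binary.Reasoning.Setoid setoid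
  open CommutativeMonoidSolver *-commutativeMonoid using (solve; _⊜_) renaming (_⊕_ to _·_)
  open RingProperties ring using (-1*x≈-x; -‿distribˡ-*; -‿+-comm; -‿involutive)
  open CommutativeSemigroupProperties +-commutativeSemigroup using () renaming (interchange to +-interchange)

  natR-+ : ∀ a b → natR (a +ℕ b) ≈ natR a + natR b
  natR-+ zero    b = sym (+-identityˡ _)
  natR-+ (suc a) b = trans (+-congˡ (natR-+ a b)) (sym (+-assoc _ _ _))

  natR-* : ∀ a b → natR (a *ℕ b) ≈ natR a * natR b
  natR-* zero    b = sym (zeroˡ _)
  natR-* (suc a) b = begin
    natR (b +ℕ a *ℕ b)              ≈⟨ natR-+ b (a *ℕ b) ⟩
    natR b + natR (a *ℕ b)          ≈⟨ +-cong (sym (*-identityˡ _)) (natR-* a b) ⟩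
    1# * natR b + natR a * natR b   ≈⟨ distribʳ _ _ _ ⟨
    (1# + natR a) * natR b          ∎

  natR-1 : natR 1 ≈ 1#
  natR-1 = +-identityʳ 1#

  sgn-+ : ∀ a b → sgn (a +ℕ b) ≈ sgn a * sgn b
  sgn-+ zero    b = sym (*-identityˡ _)
  sgn-+ (suc a) b = trans (-‿cong (sgn-+ a b)) (-‿distribˡ-* _ _)

  sgn-as-power : ∀ k → powR (- 1#) k ≈ sgn k
  sgn-as-power zero    = refl
  sgn-as-power (suc k) = trans (*-congˡ (sgn-as-power k)) (-1*x≈-x _)

  sumTo-cong≤ : ∀ n {f g : ℕ → Carrier} → (∀ i → i ≤ n → f i ≈ g i) → sumTo n f ≈ sumTo n g
  sumTo-cong≤ zero    f≈g = f≈g 0 z≤n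
  sumTo-cong≤ (suc n) f≈g = +-cong (sumTo-cong≤ n (λ i i≤n → f≈g i (ℕₚ.m≤n⇒m≤1+n i≤n))) (f≈g (suc n) ℕₚ.≤-refl)

  sumTo-cong : ∀ n {f g : ℕ → Carrier} → (∀ i → f i ≈ g i) → sumTo n f ≈ sumTo n g
  sumTo-cong n f≈g = sumTo-cong≤ n (λ i _ → f≈g i)

  sumTo-zero : ∀ n (f : ℕ → Carrier) → (∀ i → i ≤ n → f i ≈ 0#) → sumTo n f ≈ 0#
  sumTo-zero n f f≈0 = trans (sumTo-cong≤ n f≈0) (zeros n)
    where
    zeros : ∀ m → sumTo m (λ _ → 0#) ≈ 0#
    zeros zero    = refl
    zeros (suc m) = trans (+-congʳ (zeros m)) (+-identityˡ 0#)

  sumTo-+ : ∀ n (f g : ℕ → Carrier) → sumTo n (λ i → f i + g i) ≈ sumTo n f + sumTo n g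
  sumTo-+ zero    f g = refl
  sumTo-+ (suc n) f g = trans (+-congʳ (sumTo-+ n f g)) (+-interchange _ _ _ _)

  sumTo-*ˡ : ∀ n a (f : ℕ → Carrier) → a * sumTo n f ≈ sumTo n (λ i → a * f i)
  sumTo-*ˡ zero    a f = refl
  sumTo-*ˡ (suc n) a f = trans (distribˡ a _ _) (+-congʳ (sumTo-*ˡ n a f))

  sumTo-*ʳ : ∀ n a (f : ℕ → Carrier) → sumTo n f * a ≈ sumTo n (λ i → f i * a)
  sumTo-*ʳ zero    a f = refl
  sumTo-*ʳ (suc n) a f = trans (distribʳ a _ _) (+-congʳ (sumTo-*ʳ n a f))

  sumTo-head : ∀ n (f : ℕ → Carrier) → sumTo (suc n) f ≈ f 0 + sumTo n (λ i → f (suc i))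
  sumTo-head zero    f = refl
  sumTo-head (suc n) f = trans (+-congʳ (sumTo-head n f)) (+-assoc _ _ _)

  sumTo-reverse : ∀ n (f : ℕ → Carrier) → sumTo n f ≈ sumTo n (λ i → f (n ∸ℕ i))
  sumTo-reverse zero    f = refl
  sumTo-reverse (suc n) f = begin
    sumTo (suc n) f                            ≈⟨ sumTo-head n f ⟩
    f 0 + sumTo n (λ i → f (suc i))            ≈⟨ +-congˡ (sumTo-reverse n (λ i → f (suc i))) ⟩
    f 0 + sumTo n (λ i → f (suc (n ∸ℕ i)))     ≈⟨ +-comm _ _ ⟩
    sumTo n (λ i → f (suc (n ∸ℕ i))) + f 0     ≈⟨ +-cong (sumTo-cong≤ n (λ i i≤n → reflexive (≡.cong f (≡.sym (ℕₚ.+-∸-assoc 1 i≤n)))))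
                                                          (reflexive (≡.cong f (≡.sym (ℕₚ.n∸n≡0 n)))) ⟩
    sumTo (suc n) (λ i → f (suc n ∸ℕ i))       ∎

  -- Summing over the triangle {i ≤ m ≤ n} by rows or by columns:
  --   Σ_{m≤n} Σ_{i≤m} h m i = Σ_{i≤n} Σ_{j≤n-i} h (i+j) i.
  -- Gives associativity of convolution.
  sumTo-triangle : ∀ n (h : ℕ → ℕ → Carrier) →
    sumTo n (λ m → sumTo m (h m)) ≈ sumTo n (λ i → sumTo (n ∸ℕ i) (λ j → h (i +ℕ j) i))
  sumTo-triangle zero    h = refl
  sumTo-triangle (suc n) h = begin
    sumTo n (λ m → sumTo m (h m)) + (sumTo n (h (suc n)) + h (suc n) (suc n))
      ≈⟨ +-congʳ (sumTo-triangle n h) ⟩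
    Columns n + (sumTo n (h (suc n)) + h (suc n) (suc n))
      ≈⟨ +-assoc _ _ _ ⟨
    (Columns n + sumTo n (h (suc n))) + h (suc n) (suc n)
      ≈⟨ +-congʳ (sumTo-+ n _ _) ⟨
    sumTo n (λ i → column n i + h (suc n) i) + h (suc n) (suc n)
      ≈⟨ +-cong (sumTo-cong≤ n extendColumn) lastColumn ⟩
    Columns (suc n) ∎
    where
    column : ℕ → ℕ → Carrier
    column m i = sumTo (m ∸ℕ i) (λ j → h (i +ℕ j) i)
    Columns : ℕ → Carrier
    Columns m = sumTo m (column m)
    extendColumn : ∀ i → i ≤ n → column n i + h (suc n) i ≈ column (suc n) i
    extendColumn i i≤n = begin
      column n i + h (suc n) i                      ≈⟨ +-congˡ (reflexive (≡.cong (λ m → h m i) i+[n-i+1]≡n+1)) ⟨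
      sumTo (suc (n ∸ℕ i)) (λ j → h (i +ℕ j) i)     ≈⟨ reflexive (≡.cong (λ m → sumTo m (λ j → h (i +ℕ j) i)) (≡.sym (ℕₚ.+-∸-assoc 1 i≤n))) ⟩
      column (suc n) i                              ∎
      where
      i+[n-i+1]≡n+1 : i +ℕ suc (n ∸ℕ i) ≡ suc n
      i+[n-i+1]≡n+1 = ≡.trans (ℕₚ.+-suc i (n ∸ℕ i)) (≡.cong suc (ℕₚ.m+[n∸m]≡n i≤n))
    lastColumn : h (suc n) (suc n) ≈ column (suc n) (suc n)
    lastColumn = reflexive (≡.trans (≡.cong (λ m → h m (suc n)) (≡.sym (ℕₚ.+-identityʳ (suc n))))
                                    (≡.cong (λ m → sumTo m (λ j → h (suc n +ℕ j) (suc n))) (≡.sym (ℕₚ.n∸n≡0 n))))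

  infix 4 _≋_
  _≋_ : EGF → EGF → Set ℓ
  a ≋ b = ∀ n → a n ≈ b n

  constE-0# : ∀ m → constE 0# m ≈ 0#
  constE-0# zero    = refl
  constE-0# (suc m) = refl

  ⋆-cong : ∀ {a a' b b'} → a ≋ a' → b ≋ b' → (a ⋆ b) ≋ (a' ⋆ b')
  ⋆-cong a≋a' b≋b' n = sumTo-cong n (λ d → *-congˡ (*-cong (a≋a' d) (b≋b' (n ∸ℕ d))))

  ⋆-comm : ∀ a b → (a ⋆ b) ≋ (b ⋆ a)
  ⋆-comm a b n = trans (sumTo-reverse n _) (sumTo-cong≤ n reflected)
    where
    reflected : ∀ d → d ≤ n →
      natR (n C (n ∸ℕ d)) * (a (n ∸ℕ d) * b (n ∸ℕ (n ∸ℕ d))) ≈ natR (n C d) * (b d * a (n ∸ℕ d))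
    reflected d d≤n = *-cong (reflexive (≡.cong natR (≡.sym (nCk≡nC[n∸k] d≤n))))
                             (trans (*-congˡ (reflexive (≡.cong b (ℕₚ.m∸[m∸n]≡n d≤n)))) (*-comm _ _))

  ⋆-identityʳ : ∀ a → (a ⋆ constE 1#) ≋ a
  ⋆-identityʳ a zero    = trans (*-cong natR-1 (*-identityʳ _)) (*-identityˡ _)
  ⋆-identityʳ a (suc n) = begin
    sumTo n term + natR (suc n C suc n) * (a (suc n) * constE 1# (suc n ∸ℕ suc n))
      ≈⟨ +-cong (sumTo-zero n term vanishes)
                (*-cong (trans (reflexive (≡.cong natR (nCn≡1 (suc n)))) natR-1)
                        (*-congˡ (reflexive (≡.cong (constE 1#) (ℕₚ.n∸n≡0 n))))) ⟩
    0# + 1# * (a (suc n) * 1#)   ≈⟨ +-identityˡ _ ⟩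
    1# * (a (suc n) * 1#)        ≈⟨ *-identityˡ _ ⟩
    a (suc n) * 1#               ≈⟨ *-identityʳ _ ⟩
    a (suc n)                    ∎
    where
    term : ℕ → Carrier
    term d = natR (suc n C d) * (a d * constE 1# (suc n ∸ℕ d))
    -- only the last term meets the constant coefficient of 1
    vanishes : ∀ d → d ≤ n → term d ≈ 0#
    vanishes d d≤n = trans (*-congˡ (*-congˡ (reflexive (≡.cong (constE 1#) (ℕₚ.+-∸-assoc 1 d≤n)))))
                           (trans (*-congˡ (zeroʳ _)) (zeroʳ _))

  ⋆-zeroʳ : ∀ a → (a ⋆ constE 0#) ≋ constE 0#
  ⋆-zeroʳ a zero    = trans (*-congˡ (zeroʳ _)) (zeroʳ _)
  ⋆-zeroʳ a (suc n) = sumTo-zero (suc n) _ (λ d _ →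
    trans (*-congˡ (*-congˡ (constE-0# (suc n ∸ℕ d)))) (trans (*-congˡ (zeroʳ _)) (zeroʳ _)))

  ⋆-distribˡ : ∀ a b b' → (a ⋆ (b ⊕ b')) ≋ ((a ⋆ b) ⊕ (a ⋆ b'))
  ⋆-distribˡ a b b' n = trans (sumTo-cong n (λ d → trans (*-congˡ (distribˡ _ _ _)) (distribˡ _ _ _)))
                              (sumTo-+ n _ _)

  ⋆-assoc : ∀ a b e → ((a ⋆ b) ⋆ e) ≋ (a ⋆ (b ⋆ e))
  ⋆-assoc a b e n = begin
    ((a ⋆ b) ⋆ e) n                                        ≈⟨ sumTo-cong n expandLeft ⟩
    sumTo n (λ m → sumTo m (H m))                          ≈⟨ sumTo-triangle n H ⟩
    sumTo n (λ i → sumTo (n ∸ℕ i) (λ j → H (i +ℕ j) i))    ≈⟨ sumTo-cong≤ n (λ i i≤n → sumTo-cong≤ (n ∸ℕ i) (H≈K i≤n)) ⟩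
    sumTo n (λ i → sumTo (n ∸ℕ i) (K i))                   ≈⟨ sumTo-cong n expandRight ⟨
    (a ⋆ (b ⋆ e)) n                                        ∎
    where
    -- the triple products indexed as in (a⋆b)⋆e and as in a⋆(b⋆e)
    H : ℕ → ℕ → Carrier
    H m i = (natR (n C m) * natR (m C i)) * ((a i * b (m ∸ℕ i)) * e (n ∸ℕ m))
    K : ℕ → ℕ → Carrier
    K i j = (natR (n C i) * natR ((n ∸ℕ i) C j)) * ((a i * b j) * e (n ∸ℕ i ∸ℕ j))
    expandLeft : ∀ m → natR (n C m) * ((a ⋆ b) m * e (n ∸ℕ m)) ≈ sumTo m (H m)
    expandLeft m = trans (*-congˡ (sumTo-*ʳ m _ _)) (trans (sumTo-*ˡ m _ _) (sumTo-cong m (λ i →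
      solve 5 (λ x y u v w → x · ((y · (u · v)) · w) ⊜ (x · y) · ((u · v) · w)) refl
              (natR (n C m)) (natR (m C i)) (a i) (b (m ∸ℕ i)) (e (n ∸ℕ m)))))
    expandRight : ∀ i → natR (n C i) * (a i * (b ⋆ e) (n ∸ℕ i)) ≈ sumTo (n ∸ℕ i) (K i)
    expandRight i = trans (*-congˡ (sumTo-*ˡ (n ∸ℕ i) _ _)) (trans (sumTo-*ˡ (n ∸ℕ i) _ _) (sumTo-cong (n ∸ℕ i) (λ j →
      solve 5 (λ x y u v w → x · (u · (y · (v · w))) ⊜ (x · y) · ((u · v) · w)) refl
              (natR (n C i)) (natR ((n ∸ℕ i) C j)) (a i) (b j) (e (n ∸ℕ i ∸ℕ j)))))
    H≈K : ∀ {i} → i ≤ n → ∀ j → j ≤ n ∸ℕ i → H (i +ℕ j) i ≈ K i j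
    H≈K {i} i≤n j j≤n∸i = *-cong
      (trans (sym (natR-* (n C (i +ℕ j)) _))
             (trans (reflexive (≡.cong natR (choose-choose n i j i+j≤n))) (natR-* (n C i) _)))
      (*-cong (*-congˡ (reflexive (≡.cong b (ℕₚ.m+n∸m≡n i j))))
              (reflexive (≡.cong e (≡.sym (ℕₚ.∸-+-assoc n i j)))))
      where
      i+j≤n : i +ℕ j ≤ n
      i+j≤n = ≡.subst (_≤ n) (ℕₚ.+-comm j i) (ℕₚ.m≤o∸n⇒m+n≤o j i≤n j≤n∸i)

  -- EGFs under ⊕ and ⋆ form a commutative semiring (the left-sided laws
  -- follow from the right-sided ones by commutativity).
  egfCommutativeSemiring : CommutativeSemiring c ℓ
  egfCommutativeSemiring = record
    { Carrier = EGF ; _≈_ = _≋_ ; _+_ = _⊕_ ; _*_ = _⋆_ ; 0# = constE 0# ; 1# = constE 1#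
    ; isCommutativeSemiring = isCommutativeSemiringʳ record
      { +-isCommutativeMonoid = isCommutativeMonoidʳ record
        { isSemigroup = record
          { isMagma = record { isEquivalence = ≋-isEquivalence ; ∙-cong = λ p q n → +-cong (p n) (q n) }
          ; assoc = λ a b e n → +-assoc (a n) (b n) (e n) }
        ; identityʳ = ⊕-identityʳ
        ; comm = λ a b n → +-comm (a n) (b n) }
      ; *-isCommutativeMonoid = isCommutativeMonoidʳ record
        { isSemigroup = record
          { isMagma = record { isEquivalence = ≋-isEquivalence ; ∙-cong = ⋆-cong }
          ; assoc = ⋆-assoc }
        ; identityʳ = ⋆-identityʳ
        ; comm = ⋆-comm }
      ; distribˡ = ⋆-distribˡ
      ; zeroʳ = ⋆-zeroʳ } }
    where
    ≋-isEquivalence : IsEquivalence _≋_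
    ≋-isEquivalence = record { refl = λ n → refl ; sym = λ p n → sym (p n) ; trans = λ p q n → trans (p n) (q n) }
    ⊕-identityʳ : ∀ a → (a ⊕ constE 0#) ≋ a
    ⊕-identityʳ a zero    = +-identityʳ (a zero)
    ⊕-identityʳ a (suc n) = +-identityʳ (a (suc n))

  powE-binomial : ∀ a b k n →
    powE (a ⊕ b) k n ≈ sumTo k (λ j → natR (k C j) * (powE a j ⋆ powE b (k ∸ℕ j)) n)
  powE-binomial a b k n = begin
    powE (a ⊕ b) k n
      ≈⟨ powE≋^ (a ⊕ b) k n ⟨
    ((a ⊕ b) ^ᴱ k) n
      ≈⟨ Binomial.theorem egfCommutativeSemiring k a b n ⟩
    sumᴱ {suc k} (λ j → (k C toℕ j) ×ᴱ term (toℕ j)) n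
      ≈⟨ sum-coefficient k (λ j → (k C j) ×ᴱ term j) n ⟩
    sumTo k (λ j → ((k C j) ×ᴱ term j) n)
      ≈⟨ sumTo-cong k (λ j → trans (×-coefficient (k C j) (term j) n)
                                   (*-congˡ (⋆-cong (powE≋^ a j) (powE≋^ b (k ∸ℕ j)) n))) ⟩
    sumTo k (λ j → natR (k C j) * (powE a j ⋆ powE b (k ∸ℕ j)) n) ∎
    where
    open RawSemiringDefinitions (CommutativeSemiring.rawSemiring egfCommutativeSemiring)
      using () renaming (_^_ to _^ᴱ_; _×_ to _×ᴱ_; sum to sumᴱ)
    term : ℕ → EGF
    term j = (a ^ᴱ j) ⋆ (b ^ᴱ (k ∸ℕ j))
    powE≋^ : ∀ x m → (x ^ᴱ m) ≋ powE x m
    powE≋^ x zero    = λ n → refl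
    powE≋^ x (suc m) = ⋆-cong (λ n → refl) (powE≋^ x m)
    ×-coefficient : ∀ m x n → (m ×ᴱ x) n ≈ natR m * x n
    ×-coefficient zero    x n = trans (constE-0# n) (sym (zeroˡ _))
    ×-coefficient (suc m) x n = trans (+-cong (sym (*-identityˡ _)) (×-coefficient m x n)) (sym (distribʳ _ _ _))
    sum-coefficient : ∀ N (g : ℕ → EGF) n → sumᴱ {suc N} (λ j → g (toℕ j)) n ≈ sumTo N (λ j → g j n)
    sum-coefficient zero    g n = trans (+-congˡ (constE-0# n)) (+-identityʳ _)
    sum-coefficient (suc N) g n = trans (+-congˡ (sum-coefficient N (λ j → g (suc j)) n)) (sym (sumTo-head N _))

  powE-cong : ∀ {a b} → a ≋ b → ∀ k → powE a k ≋ powE b k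
  powE-cong a≋b zero    = λ n → refl
  powE-cong a≋b (suc k) = ⋆-cong a≋b (powE-cong a≋b k)

  scaleE : Carrier → EGF → EGF
  scaleE r a n = r * a n

  ⋆-scaleˡ : ∀ r a b → (scaleE r a ⋆ b) ≋ scaleE r (a ⋆ b)
  ⋆-scaleˡ r a b n = trans (sumTo-cong n (λ d →
      solve 4 (λ x s u v → x · ((s · u) · v) ⊜ s · (x · (u · v))) refl (natR (n C d)) r (a d) (b (n ∸ℕ d))))
    (sym (sumTo-*ˡ n r _))

  powE-scale : ∀ r a k → powE (scaleE r a) k ≋ scaleE (powR r k) (powE a k)
  powE-scale r a zero    n = sym (*-identityˡ _)
  powE-scale r a (suc k) n = begin
    (scaleE r a ⋆ powE (scaleE r a) k) n             ≈⟨ ⋆-cong (λ m → refl) (powE-scale r a k) n ⟩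
    (scaleE r a ⋆ scaleE (powR r k) (powE a k)) n    ≈⟨ ⋆-scaleˡ r a (scaleE (powR r k) (powE a k)) n ⟩
    r * (a ⋆ scaleE (powR r k) (powE a k)) n         ≈⟨ *-congˡ (trans (⋆-comm a _ n) (⋆-scaleˡ (powR r k) (powE a k) a n)) ⟩
    r * (powR r k * (powE a k ⋆ a) n)                ≈⟨ *-congˡ (*-congˡ (⋆-comm (powE a k) a n)) ⟩
    r * (powR r k * (a ⋆ powE a k) n)                ≈⟨ *-assoc _ _ _ ⟨
    (r * powR r k) * (a ⋆ powE a k) n                ∎

  -- The sign twist σ a = a(-t) is multiplicative, hence commutes with powers.

  σ : EGF → EGF
  σ a n = sgn n * a n

  σ-⋆ : ∀ a b → σ (a ⋆ b) ≋ (σ a ⋆ σ b)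
  σ-⋆ a b n = trans (sumTo-*ˡ n (sgn n) _) (sumTo-cong≤ n signSplit)
    where
    signSplit : ∀ d → d ≤ n →
      sgn n * (natR (n C d) * (a d * b (n ∸ℕ d))) ≈ natR (n C d) * ((sgn d * a d) * (sgn (n ∸ℕ d) * b (n ∸ℕ d)))
    signSplit d d≤n = trans
      (*-congʳ (trans (reflexive (≡.cong sgn (≡.sym (ℕₚ.m+[n∸m]≡n d≤n)))) (sgn-+ d (n ∸ℕ d))))
      (solve 5 (λ s s' x u v → (s · s') · (x · (u · v)) ⊜ x · ((s · u) · (s' · v))) refl
             (sgn d) (sgn (n ∸ℕ d)) (natR (n C d)) (a d) (b (n ∸ℕ d)))

  σ-powE : ∀ a k → σ (powE a k) ≋ powE (σ a) k
  σ-powE a zero    zero    = *-identityˡ _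
  σ-powE a zero    (suc n) = zeroʳ _
  σ-powE a (suc k) n       = trans (σ-⋆ a (powE a k) n) (⋆-cong (λ m → refl) (σ-powE a k) n)

  module _ (invertible : ∀ m → natR (suc m) * inv m ≈ 1#) where

    factorial-inverse : ∀ m → natR (m !ℕ) * invFact m ≈ 1#
    factorial-inverse zero    = trans (*-identityʳ _) natR-1
    factorial-inverse (suc m) = begin
      natR (suc m *ℕ m !ℕ) * (inv m * invFact m)               ≈⟨ *-congʳ (natR-* (suc m) (m !ℕ)) ⟩
      (natR (suc m) * natR (m !ℕ)) * (inv m * invFact m)       ≈⟨ solve 4 (λ x y u v → (x · y) · (u · v) ⊜ (x · u) · (y · v)) refl _ _ _ _ ⟩
      (natR (suc m) * inv m) * (natR (m !ℕ) * invFact m)       ≈⟨ *-cong (invertible m) (factorial-inverse m) ⟩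
      1# * 1#                                                  ≈⟨ *-identityʳ _ ⟩
      1#                                                       ∎

    choose-as-fraction : ∀ k j → j ≤ k → natR (k !ℕ) * (invFact j * invFact (k ∸ℕ j)) ≈ natR (k C j)
    choose-as-fraction k j j≤k = begin
      natR (k !ℕ) * (invFact j * invFact (k ∸ℕ j))
        ≈⟨ *-congʳ (reflexive (≡.cong natR (≡.sym (choose-factorial j≤k)))) ⟩
      natR ((k C j) *ℕ (j !ℕ *ℕ (k ∸ℕ j) !ℕ)) * (invFact j * invFact (k ∸ℕ j))
        ≈⟨ *-congʳ (trans (natR-* (k C j) _) (*-congˡ (natR-* (j !ℕ) _))) ⟩
      (natR (k C j) * (natR (j !ℕ) * natR ((k ∸ℕ j) !ℕ))) * (invFact j * invFact (k ∸ℕ j))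
        ≈⟨ solve 5 (λ x y z u v → (x · (y · z)) · (u · v) ⊜ x · ((y · u) · (z · v))) refl _ _ _ _ _ ⟩
      natR (k C j) * ((natR (j !ℕ) * invFact j) * (natR ((k ∸ℕ j) !ℕ) * invFact (k ∸ℕ j)))
        ≈⟨ *-congˡ (trans (*-cong (factorial-inverse j) (factorial-inverse (k ∸ℕ j))) (*-identityʳ 1#)) ⟩
      natR (k C j) * 1#
        ≈⟨ *-identityʳ _ ⟩
      natR (k C j) ∎

    sum-choose-as-fraction : ∀ k (f : ℕ → Carrier) →
      sumTo k (λ j → natR (k C j) * f j) ≈ natR (k !ℕ) * sumTo k (λ j → (invFact j * invFact (k ∸ℕ j)) * f j)
    sum-choose-as-fraction k f = sym (trans (sumTo-*ˡ k _ _) (sumTo-cong≤ k (λ j j≤k →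
      trans (sym (*-assoc _ _ _)) (*-congʳ (choose-as-fraction k j j≤k)))))

  stirlingE : Carrier → EGF
  stirlingE r = expE r ⊕ constE (- 1#)

  y2Series : Carrier → Carrier → EGF
  y2Series r r' = (expE r ⊕ expNegE r') ⊕ constE (natR 2)

  negated-y2Series : ∀ r r' → y2Series (- r) (- r') ≋ scaleE (- 1#) (stirlingE r ⊕ σ (stirlingE r'))
  negated-y2Series r r' zero = sym (begin
    - 1# * ((r + - 1#) + 1# * (r' + - 1#))   ≈⟨ -1*x≈-x _ ⟩
    - ((r + - 1#) + 1# * (r' + - 1#))        ≈⟨ -‿cong (+-congˡ (*-identityˡ _)) ⟩
    - ((r + - 1#) + (r' + - 1#))             ≈⟨ -‿+-comm _ _ ⟨
    - (r + - 1#) + - (r' + - 1#)             ≈⟨ +-cong (-‿+-comm _ _) (-‿+-comm _ _) ⟨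
    (- r + - - 1#) + (- r' + - - 1#)         ≈⟨ +-cong (+-congˡ (-‿involutive _)) (+-congˡ (-‿involutive _)) ⟩
    (- r + 1#) + (- r' + 1#)                 ≈⟨ +-interchange _ _ _ _ ⟩
    (- r + - r') + (1# + 1#)                 ≈⟨ +-cong (+-congˡ (sym (*-identityʳ _))) (+-congˡ (sym (+-identityʳ _))) ⟩
    (- r + - r' * 1#) + (1# + (1# + 0#))     ∎)
  negated-y2Series r r' (suc n) = sym (begin
    - 1# * ((r + 0#) + s * (r' + 0#))   ≈⟨ -1*x≈-x _ ⟩
    - ((r + 0#) + s * (r' + 0#))        ≈⟨ -‿cong (+-cong (+-identityʳ _) (trans (*-congˡ (+-identityʳ _)) (*-comm _ _))) ⟩
    - (r + r' * s)                      ≈⟨ -‿+-comm _ _ ⟨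
    - r + - (r' * s)                    ≈⟨ +-congˡ (-‿distribˡ-* _ _) ⟩
    - r + - r' * s                      ≈⟨ +-identityʳ _ ⟨
    (- r + - r' * s) + 0#               ∎)
    where
    s : Carrier
    s = sgn (suc n)

  y2-binomial-expansion : ∀ r r' n k →
    y2 n k (- r) (- r') ≈ invFact (k +ℕ k) * (sgn k *
      sumTo k (λ j → natR (k C j) * (powE (stirlingE r) j ⋆ powE (σ (stirlingE r')) (k ∸ℕ j)) n))
  y2-binomial-expansion r r' n k = *-congˡ (begin
    powE (y2Series (- r) (- r')) k n       ≈⟨ powE-cong (negated-y2Series r r') k n ⟩
    powE (scaleE (- 1#) (A ⊕ B)) k n        ≈⟨ powE-scale (- 1#) (A ⊕ B) k n ⟩
    powR (- 1#) k * powE (A ⊕ B) k n        ≈⟨ *-cong (sgn-as-power k) (powE-binomial A B k n) ⟩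
    sgn k * sumTo k (λ j → natR (k C j) * (powE A j ⋆ powE B (k ∸ℕ j)) n) ∎)
    where
    A B : EGF
    A = stirlingE r
    B = σ (stirlingE r')

  stirling-convolution : ∀ r r' n k j →
    sumTo n (λ d → sgn ((k +ℕ n) ∸ℕ d) * (natR (n C d) * (S2 d j r * S2 (n ∸ℕ d) (k ∸ℕ j) r'))) ≈
      sgn k * ((invFact j * invFact (k ∸ℕ j)) * (powE (stirlingE r) j ⋆ powE (σ (stirlingE r')) (k ∸ℕ j)) n)
  stirling-convolution r r' n k j = begin
    sumTo n (λ d → sgn ((k +ℕ n) ∸ℕ d) * (natR (n C d) * (S2 d j r * S2 (n ∸ℕ d) (k ∸ℕ j) r')))
      ≈⟨ sumTo-cong≤ n regroup ⟩
    sumTo n (λ d → (sgn k * (invFact j * invFact (k ∸ℕ j))) * (natR (n C d) * (powE A j d * σ (powE A' (k ∸ℕ j)) (n ∸ℕ d))))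
      ≈⟨ sumTo-*ˡ n _ _ ⟨
    (sgn k * (invFact j * invFact (k ∸ℕ j))) * (powE A j ⋆ σ (powE A' (k ∸ℕ j))) n
      ≈⟨ *-cong refl (⋆-cong (λ m → refl) (σ-powE A' (k ∸ℕ j)) n) ⟩
    (sgn k * (invFact j * invFact (k ∸ℕ j))) * (powE A j ⋆ powE (σ A') (k ∸ℕ j)) n
      ≈⟨ *-assoc _ _ _ ⟩
    sgn k * ((invFact j * invFact (k ∸ℕ j)) * (powE A j ⋆ powE (σ A') (k ∸ℕ j)) n) ∎
    where
    A A' : EGF
    A  = stirlingE r
    A' = stirlingE r'
    regroup : ∀ d → d ≤ n →
      sgn ((k +ℕ n) ∸ℕ d) * (natR (n C d) * (S2 d j r * S2 (n ∸ℕ d) (k ∸ℕ j) r')) ≈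
        (sgn k * (invFact j * invFact (k ∸ℕ j))) * (natR (n C d) * (powE A j d * σ (powE A' (k ∸ℕ j)) (n ∸ℕ d)))
    regroup d d≤n = trans
      (*-congʳ (trans (reflexive (≡.cong sgn (ℕₚ.+-∸-assoc k d≤n))) (sgn-+ k (n ∸ℕ d))))
      (solve 7 (λ s s' x i u i' v → (s · s') · (x · ((i · u) · (i' · v))) ⊜ (s · (i · i')) · (x · (u · (s' · v)))) refl
             (sgn k) (sgn (n ∸ℕ d)) (natR (n C d)) (invFact j) (powE A j d) (invFact (k ∸ℕ j)) (powE A' (k ∸ℕ j) (n ∸ℕ d)))

mainTheorem4 : ∀ {c ℓ : Level} (R : CommutativeRing c ℓ) (inv : ℕ → CommutativeRing.Carrier R) →
    let open CommutativeRing R in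
    let open Gen R inv in
    (∀ m → natR (suc m) * inv m ≈ 1#) →
    ∀ (lam lam' : Carrier) → lam * lam' ≈ 1# →
    ∀ (n k : ℕ) →
    y2 n k (- lam) (- lam') ≈
      (natR (k !ℕ) * invFact (k +ℕ k)) *
        sumTo k (λ j → sumTo n (λ d →
          sgn ((k +ℕ n) ∸ℕ d) * (natR (n C d) * (S2 d j lam * S2 (n ∸ℕ d) (k ∸ℕ j) lam'))))
mainTheorem4 R inv invertible lam lam' _ n k = begin
  y2 n k (- lam) (- lam')
    ≈⟨ y2-binomial-expansion lam lam' n k ⟩
  i * (s * sumTo k (λ j → natR (k C j) * P j))
    ≈⟨ *-congˡ (*-congˡ (sum-choose-as-fraction invertible k P)) ⟩
  i * (s * (f * sumTo k (λ j → c j * P j)))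
    ≈⟨ solve 4 (λ i s f Σ → i · (s · (f · Σ)) ⊜ (f · i) · (s · Σ)) refl i s f _ ⟩
  (f * i) * (s * sumTo k (λ j → c j * P j))
    ≈⟨ *-congˡ (sumTo-*ˡ k s _) ⟩
  (f * i) * sumTo k (λ j → s * (c j * P j))
    ≈⟨ *-congˡ (sumTo-cong k (stirling-convolution lam lam' n k)) ⟨
  (f * i) * sumTo k (λ j → sumTo n (λ d →
      sgn ((k +ℕ n) ∸ℕ d) * (natR (n C d) * (S2 d j lam * S2 (n ∸ℕ d) (k ∸ℕ j) lam')))) ∎
  where
  open CommutativeRing R hiding (zero)
  open Gen R inv
  open Development R inv
  open import Relation.Binary.Reasoning.Setoid setoid
  open CommutativeMonoidSolver *-commutativeMonoid using (solve; _⊜_) renaming (_⊕_ to _·_)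
  i s f : Carrier
  i = invFact (k +ℕ k)
  s = sgn k
  f = natR (k !ℕ)
  c : ℕ → Carrier
  c j = invFact j * invFact (k ∸ℕ j)
  P : ℕ → Carrier
  P j = (powE (stirlingE lam) j ⋆ powE (σ (stirlingE lam')) (k ∸ℕ j)) n
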